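{- Let $G$ be a graph of even order $n \geq 6$ with degree sequence $4, 2, 2, \ldots, 2$ (that is, one vertex of degree $4$ and all other $n-1$ vertices of degree $2$). Then $G$ is not super edge-magic.
   Context: All graphs are finite, without loops or multiple edges. A graph $G$ is super edge-magic if there exists a bijective function $f:V(G) \cup E(G)\rightarrow \{1, 2, \ldots , |V(G)| + |E(G)|\}$ such that $f(V(G)) =\{1, 2, \ldots , |V(G)|\}$ and $f(u) + f(v) + f(uv)$ is the same constant for every edge $uv\in E(G)$. -}

module Defs where

open import Data.Nat using (ℕ; zero; suc; _+_; _<_)
open import Data.Fin using (Fin; toℕ; inject+; raise)
open import Data.Fin.Properties using ()
open import Data.Bool using (Bool; true; false)
open import Data.Sum using (_⊎_; inj₁; inj₂)
open import Data.Product using (Σ; _×_; _,_; ∃)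
open import Data.List using (List; length; filter; allFin; lookup)
open import Data.List.Properties using ()
open import Relation.Binary.PropositionalEquality using (_≡_; _≢_)
open import Relation.Nullary using (¬_)
open import Function.Bundles using (_⤖_)
open import Data.Fin using (_<?_)

record Graph (n : ℕ) : Set where
  field
    adj   : Fin n → Fin n → Bool
    sym   : ∀ i j → adj i j ≡ adj j i
    irrefl : ∀ i → adj i i ≡ false

open Graph public

-- The set of edges: unordered pairs {i,j} represented uniquely by i < j.
allPairs : (n : ℕ) → List (Fin n × Fin n)
allPairs n = Data.List.concatMap (λ i → Data.List.map (λ j → i , j) (allFin n)) (allFin n)

edgeList : {n : ℕ} → Graph n → List (Fin n × Fin n)
edgeList {n} G = filter (λ { (i , j) → (i <? j) Relation.Nullary.×-dec (adj G i j Data.Bool.Properties.≟ true) }) (allPairs n)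
  where import Data.Bool.Properties
        import Relation.Nullary

size : {n : ℕ} → Graph n → ℕ
size G = length (edgeList G)

degree : {n : ℕ} → Graph n → Fin n → ℕ
degree {n} G v = length (filter (λ u → adj G v u Data.Bool.Properties.≟ true) (allFin n))
  where import Data.Bool.Properties

edgeAt : {n : ℕ} (G : Graph n) → Fin (size G) → Fin n × Fin n
edgeAt G k = lookup (edgeList G) k

-- Super edge-magic: a bijection f from V(G) ⊎ E(G) onto {1,…,|V|+|E|}
-- (here represented as Fin (|V|+|E|), where label ℓ corresponds to toℕ ℓ + 1),
-- with f(V(G)) = {1,…,|V|}, and f(u)+f(v)+f(uv) constant over all edges uv.
label : {N : ℕ} → Fin N → ℕ
label ℓ = suc (toℕ ℓ)

IsSuperEdgeMagic : {n : ℕ} → Graph n → Set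
IsSuperEdgeMagic {n} G =
  Σ ((Fin n ⊎ Fin (size G)) ⤖ Fin (n + size G)) λ f →
    let open Function.Bundles.Bijection f renaming (to to φ) in
    (∀ x → (∃ λ v → φ (inj₁ v) ≡ x) ⇔' (label x Data.Nat.≤ n))
    × Σ ℕ λ c → ∀ k → label (φ (inj₁ (Data.Product.proj₁ (edgeAt G k))))
                        + label (φ (inj₁ (Data.Product.proj₂ (edgeAt G k))))
                        + label (φ (inj₂ k)) ≡ c
  where
    _⇔'_ : Set → Set → Set
    A ⇔' B = (A → B) × (B → A)

-- Such a graph has n + 1 edges; write n = 2k and q = 2k + 1. Summing the magic equation
-- f(u) + f(v) + f(uv) = c over all q edges counts each vertex label with multiplicity its
-- degree, so q·c = 2·(1 + ⋯ + n) + 2a + ((n + 1) + ⋯ + (n + q)), where a ≤ n is the label of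
-- the vertex of degree 4. The two arithmetic progressions sum to k·q and q·(3k + 1), so the
-- odd number q divides 2a, hence a, which is impossible for 0 < a < q.

module Submission where

open import Defs hiding (sym)
import Algebra.Properties.Semiring.Sum as ∑
open import Data.Bool using (Bool; true; false; if_then_else_; _∧_)
import Data.Bool.Properties as Bool
open import Data.Empty using (⊥-elim)
open import Data.Fin using (Fin; zero; suc; toℕ; fromℕ<; _<?_; punchIn)
open import Data.Fin.Permutation using (permutation)
open import Data.Fin.Properties using (toℕ-injective; toℕ-fromℕ<; toℕ<n; <-cmp; punchInᵢ≢i)
open import Data.List using (List; []; _∷_; _++_; length; map; filter; concatMap; allFin; tabulate; lookup)
open import Data.List.Properties using (map-++; map-∘; map-tabulate; tabulate-lookup)
open import Data.Nat using (ℕ; zero; suc; _+_; _*_; _∸_; _≤_; _<_; s≤s; z≤n; >-nonZero)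
import Data.Nat.ListAction as List
open import Data.Nat.ListAction.Properties using (sum-++)
open import Data.Nat.Properties
  using (+-*-semiring; +-identityʳ; +-suc; *-identityʳ; *-cancelˡ-≡; *-cancelʳ-≡; +-cancelʳ-≡;
         +-cancelˡ-<; +-monoʳ-<; m≤m+n; m+[n∸m]≡n; m+n∸m≡n; ≤-trans; <⇒≱; ≰⇒>; suc-injective)
open import Data.Nat.Coprimality using (Coprime; 1-coprimeTo; coprime-+; coprime-divisor)
open import Data.Nat.Divisibility using (_∣_; ∣m+n∣m⇒∣n; m∣m*n; ∣⇒≤)
open import Data.Nat.Tactic.RingSolver using (solve-∀)
open import Data.Product using (Σ; _×_; _,_; proj₁; proj₂; ∃)
open import Data.Sum using (_⊎_; inj₁; inj₂)
open import Data.Sum.Properties using (inj₁-injective; inj₂-injective)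
open import Function using (_∘_; _⤖_)
open import Function.Bundles using (Bijection)
open import Function.Definitions using (Injective)
open import Relation.Binary.Definitions using (tri<; tri≈; tri>)
open import Relation.Binary.PropositionalEquality
  using (_≡_; _≢_; refl; sym; trans; cong; cong₂; subst; module ≡-Reasoning)
open import Relation.Nullary using (¬_; does)
open import Relation.Nullary.Decidable using (dec-true; dec-false)
open import Relation.Unary using (Decidable)

open ∑ +-*-semiring
  using (sum-syntax; ∑-distrib-+; ∑-comm; sum-permute; sum-remove; sum-cong-≗; *-distribˡ-sum; *-distribʳ-sum)
open ≡-Reasoning

∑-const : ∀ m c → ∑[ i < m ] c ≡ m * c
∑-const zero    c = refl
∑-const (suc m) c = cong (c +_) (∑-const m c)

∑∑-distrib-+ : ∀ {m l} (f g : Fin m → Fin l → ℕ) →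
  ∑[ i < m ] ∑[ j < l ] (f i j + g i j) ≡ (∑[ i < m ] ∑[ j < l ] f i j) + (∑[ i < m ] ∑[ j < l ] g i j)
∑∑-distrib-+ {m} f g = trans (sum-cong-≗ (λ i → ∑-distrib-+ (f i) (g i))) (∑-distrib-+ {m} _ _)

-- Gauss's formula, doubled so that no halving occurs.
∑-arithmetic : ∀ m a → 2 * ∑[ j < m ] (a + toℕ j) + m ≡ m * (2 * a + m)
∑-arithmetic zero    a = refl
∑-arithmetic (suc m) a = begin
  2 * (a + 0 + ∑[ j < m ] (a + suc (toℕ j))) + suc m
    ≡⟨ cong (λ s → 2 * (a + 0 + s) + suc m) (sum-cong-≗ {m} (λ j → +-suc a (toℕ j))) ⟩
  2 * (a + 0 + S) + suc m          ≡⟨ peel a m S ⟩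
  2 * a + 1 + (2 * S + m)          ≡⟨ cong (2 * a + 1 +_) (∑-arithmetic m (suc a)) ⟩
  2 * a + 1 + m * (2 * suc a + m)  ≡⟨ close a m ⟩
  suc m * (2 * a + suc m)          ∎
  where
  S = ∑[ j < m ] (suc a + toℕ j)
  peel : ∀ a m S → 2 * (a + 0 + S) + suc m ≡ 2 * a + 1 + (2 * S + m)
  peel = solve-∀
  close : ∀ a m → 2 * a + 1 + m * (2 * suc a + m) ≡ suc m * (2 * a + suc m)
  close = solve-∀

∑-interval-bijection : ∀ m a (g : Fin m → ℕ) → Injective _≡_ _≡_ g →
  (∀ i → a ≤ g i) → (∀ i → g i < a + m) → (∀ y → a ≤ y → y < a + m → ∃ λ i → g i ≡ y) →
  ∑[ i < m ] g i ≡ ∑[ j < m ] (a + toℕ j)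
∑-interval-bijection m a g g-injective a≤g g<a+m g-onto =
  trans (sum-permute g (permutation χ τ χ∘τ τ∘χ)) (sum-cong-≗ gχ)
  where
  g∸a<m : ∀ i → g i ∸ a < m
  g∸a<m i = +-cancelˡ-< a _ m (subst (_< a + m) (sym (m+[n∸m]≡n (a≤g i))) (g<a+m i))
  τ : Fin m → Fin m
  τ i = fromℕ< (g∸a<m i)
  preimage : ∀ j → ∃ λ i → g i ≡ a + toℕ j
  preimage j = g-onto (a + toℕ j) (m≤m+n a (toℕ j)) (+-monoʳ-< a (toℕ<n j))
  χ : Fin m → Fin m
  χ j = proj₁ (preimage j)
  gχ : ∀ j → g (χ j) ≡ a + toℕ j
  gχ j = proj₂ (preimage j)
  χ∘τ : ∀ i → χ (τ i) ≡ i
  χ∘τ i = g-injective (trans (gχ (τ i))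
    (trans (cong (a +_) (toℕ-fromℕ< (g∸a<m i))) (m+[n∸m]≡n (a≤g i))))
  τ∘χ : ∀ j → τ (χ j) ≡ j
  τ∘χ j = toℕ-injective (trans (toℕ-fromℕ< (g∸a<m (χ j)))
    (trans (cong (_∸ a) (gχ j)) (m+n∸m≡n a (toℕ j))))

sum-tabulate : ∀ {m} (f : Fin m → ℕ) → List.sum (tabulate f) ≡ ∑[ i < m ] f i
sum-tabulate {zero}  f = refl
sum-tabulate {suc m} f = cong (f zero +_) (sum-tabulate (f ∘ suc))

sum-map-allFin : ∀ {m} (f : Fin m → ℕ) → List.sum (map f (allFin m)) ≡ ∑[ i < m ] f i
sum-map-allFin f = trans (cong List.sum (map-tabulate (λ i → i) f)) (sum-tabulate f)

module _ {A : Set} where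

  sum-map-lookup : (xs : List A) (h : A → ℕ) → ∑[ k < length xs ] h (lookup xs k) ≡ List.sum (map h xs)
  sum-map-lookup xs h = begin
    ∑[ k < length xs ] h (lookup xs k)    ≡⟨ sum-tabulate (h ∘ lookup xs) ⟨
    List.sum (tabulate (h ∘ lookup xs))  ≡⟨ cong List.sum (map-tabulate (lookup xs) h) ⟨
    List.sum (map h (tabulate (lookup xs))) ≡⟨ cong (List.sum ∘ map h) (tabulate-lookup xs) ⟩
    List.sum (map h xs)                  ∎

  length≡sum-map-1 : (xs : List A) → length xs ≡ List.sum (map (λ _ → 1) xs)
  length≡sum-map-1 []       = refl
  length≡sum-map-1 (x ∷ xs) = cong suc (length≡sum-map-1 xs)

  sum-map-filter : ∀ {P : A → Set} (P? : Decidable P) (h : A → ℕ) (xs : List A) →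
    List.sum (map h (filter P? xs)) ≡ List.sum (map (λ x → if does (P? x) then h x else 0) xs)
  sum-map-filter P? h []       = refl
  sum-map-filter P? h (x ∷ xs) with does (P? x)
  ... | true  = cong (h x +_) (sum-map-filter P? h xs)
  ... | false = sum-map-filter P? h xs

  sum-map-concatMap : ∀ {B : Set} (f : A → List B) (h : B → ℕ) (xs : List A) →
    List.sum (map h (concatMap f xs)) ≡ List.sum (map (List.sum ∘ map h ∘ f) xs)
  sum-map-concatMap f h []       = refl
  sum-map-concatMap f h (x ∷ xs) = begin
    List.sum (map h (f x ++ concatMap f xs))
      ≡⟨ cong List.sum (map-++ h (f x) _) ⟩
    List.sum (map h (f x) ++ map h (concatMap f xs))
      ≡⟨ sum-++ (map h (f x)) _ ⟩
    List.sum (map h (f x)) + List.sum (map h (concatMap f xs))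
      ≡⟨ cong (List.sum (map h (f x)) +_) (sum-map-concatMap f h xs) ⟩
    List.sum (map h (f x)) + List.sum (map (List.sum ∘ map h ∘ f) xs) ∎

if-distrib-+ : ∀ b x y → (if b then x + y else 0) ≡ (if b then x else 0) + (if b then y else 0)
if-distrib-+ true  x y = refl
if-distrib-+ false x y = refl

if-1-* : ∀ b x → (if b then 1 else 0) * x ≡ (if b then x else 0)
if-1-* true  x = +-identityʳ x
if-1-* false x = refl

does-≟-true : ∀ b → does (b Bool.≟ true) ≡ b
does-≟-true true  = refl
does-≟-true false = refl

module _ {n} (G : Graph n) where

  private
    ordered : Fin n → Fin n → Bool
    ordered i j = does (i <? j) ∧ adj G i j

  sum-map-edgeList : (h : Fin n × Fin n → ℕ) →
    List.sum (map h (edgeList G)) ≡ ∑[ i < n ] ∑[ j < n ] (if ordered i j then h (i , j) else 0)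
  sum-map-edgeList h = begin
    List.sum (map h (edgeList G))
      ≡⟨ sum-map-filter _ h (allPairs n) ⟩
    List.sum (map h′ (allPairs n))
      ≡⟨ sum-map-concatMap (λ i → map (i ,_) (allFin n)) h′ (allFin n) ⟩
    List.sum (map (λ i → List.sum (map h′ (map (i ,_) (allFin n)))) (allFin n))
      ≡⟨ sum-map-allFin (λ i → List.sum (map h′ (map (i ,_) (allFin n)))) ⟩
    ∑[ i < n ] List.sum (map h′ (map (i ,_) (allFin n)))
      ≡⟨ sum-cong-≗ {n} (λ i → cong List.sum (map-∘ (allFin n))) ⟨
    ∑[ i < n ] List.sum (map (h′ ∘ (i ,_)) (allFin n))
      ≡⟨ sum-cong-≗ {n} (λ i → sum-map-allFin (h′ ∘ (i ,_))) ⟩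
    ∑[ i < n ] ∑[ j < n ] h′ (i , j)
      ≡⟨ sum-cong-≗ {n} (λ i → sum-cong-≗ {n} (λ j →
           cong (λ b → if does (i <? j) ∧ b then h (i , j) else 0) (does-≟-true (adj G i j)))) ⟩
    ∑[ i < n ] ∑[ j < n ] (if ordered i j then h (i , j) else 0) ∎
    where
    h′ : Fin n × Fin n → ℕ
    h′ (i , j) = if does (i <? j) ∧ does (adj G i j Bool.≟ true) then h (i , j) else 0

  degree-* : ∀ v x → degree G v * x ≡ ∑[ u < n ] (if adj G v u then x else 0)
  degree-* v x = begin
    degree G v * x
      ≡⟨ cong (_* x) (length≡sum-map-1 (filter _ (allFin n))) ⟩
    List.sum (map (λ _ → 1) (filter _ (allFin n))) * x
      ≡⟨ cong (_* x) (trans (sum-map-filter _ (λ _ → 1) (allFin n))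
                            (sum-map-allFin (λ u → if does (adj G v u Bool.≟ true) then 1 else 0))) ⟩
    (∑[ u < n ] (if does (adj G v u Bool.≟ true) then 1 else 0)) * x
      ≡⟨ cong (_* x) (sum-cong-≗ {n} (λ u → cong (λ b → if b then 1 else 0) (does-≟-true (adj G v u)))) ⟩
    (∑[ u < n ] (if adj G v u then 1 else 0)) * x
      ≡⟨ *-distribʳ-sum x (λ u → if adj G v u then 1 else 0) ⟩
    ∑[ u < n ] ((if adj G v u then 1 else 0) * x)
      ≡⟨ sum-cong-≗ {n} (λ u → if-1-* (adj G v u) x) ⟩
    ∑[ u < n ] (if adj G v u then x else 0) ∎

  ordered-both-ways : ∀ i j x →
    (if ordered i j then x else 0) + (if ordered j i then x else 0) ≡ (if adj G i j then x else 0)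
  ordered-both-ways i j x with <-cmp i j
  ... | tri< i<j _ j≮i rewrite dec-true (i <? j) i<j | dec-false (j <? i) j≮i = +-identityʳ _
  ... | tri> i≮j _ j<i rewrite dec-false (i <? j) i≮j | dec-true (j <? i) j<i | Graph.sym G j i = refl
  ... | tri≈ i≮i refl _ rewrite dec-false (i <? i) i≮i | irrefl G i = refl

  weighted-handshake : (g : Fin n → ℕ) →
    ∑[ k < size G ] (g (proj₁ (edgeAt G k)) + g (proj₂ (edgeAt G k))) ≡ ∑[ v < n ] (degree G v * g v)
  weighted-handshake g = begin
    ∑[ k < size G ] endpoints (edgeAt G k)
      ≡⟨ sum-map-lookup (edgeList G) endpoints ⟩
    List.sum (map endpoints (edgeList G))
      ≡⟨ sum-map-edgeList endpoints ⟩
    ∑[ i < n ] ∑[ j < n ] (if ordered i j then g i + g j else 0)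
      ≡⟨ sum-cong-≗ {n} (λ i → sum-cong-≗ {n} (λ j → if-distrib-+ (ordered i j) (g i) (g j))) ⟩
    ∑[ i < n ] ∑[ j < n ] (left i j + right i j)
      ≡⟨ ∑∑-distrib-+ {n} {n} left right ⟩
    (∑[ i < n ] ∑[ j < n ] left i j) + (∑[ i < n ] ∑[ j < n ] right i j)
      ≡⟨ cong ((∑[ i < n ] ∑[ j < n ] left i j) +_) (∑-comm {n} right) ⟩
    (∑[ i < n ] ∑[ j < n ] left i j) + (∑[ i < n ] ∑[ j < n ] right j i)
      ≡⟨ ∑∑-distrib-+ {n} {n} left (λ i j → right j i) ⟨
    ∑[ i < n ] ∑[ j < n ] (left i j + right j i)
      ≡⟨ sum-cong-≗ {n} (λ i → sum-cong-≗ {n} (λ j → ordered-both-ways i j (g i))) ⟩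
    ∑[ i < n ] ∑[ j < n ] (if adj G i j then g i else 0)
      ≡⟨ sum-cong-≗ {n} (λ i → degree-* i (g i)) ⟨
    ∑[ i < n ] (degree G i * g i) ∎
    where
    endpoints : Fin n × Fin n → ℕ
    endpoints (u , v) = g u + g v
    left right : Fin n → Fin n → ℕ
    left  i j = if ordered i j then g i else 0
    right i j = if ordered i j then g j else 0

∑-degree-*-almostRegular : ∀ {n} (G : Graph n) (w : Fin n) {d e} →
  degree G w ≡ d + e → (∀ v → v ≢ w → degree G v ≡ d) →
  (g : Fin n → ℕ) → ∑[ v < n ] (degree G v * g v) ≡ d * ∑[ v < n ] g v + e * g w
∑-degree-*-almostRegular {suc n} G w {d} {e} deg-w deg-v g = begin
  ∑[ v < suc n ] (degree G v * g v)
    ≡⟨ sum-remove {i = w} (λ v → degree G v * g v) ⟩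
  degree G w * g w + ∑[ i < n ] (degree G (punchIn w i) * g (punchIn w i))
    ≡⟨ cong₂ _+_ (cong (_* g w) deg-w)
         (sum-cong-≗ {n} (λ i → cong (_* g (punchIn w i)) (deg-v (punchIn w i) (punchInᵢ≢i w i)))) ⟩
  (d + e) * g w + ∑[ i < n ] (d * g (punchIn w i))
    ≡⟨ cong ((d + e) * g w +_) (*-distribˡ-sum d (g ∘ punchIn w)) ⟨
  (d + e) * g w + d * ∑[ i < n ] g (punchIn w i)
    ≡⟨ regroup d e (g w) _ ⟩
  d * (g w + ∑[ i < n ] g (punchIn w i)) + e * g w
    ≡⟨ cong (λ s → d * s + e * g w) (sum-remove {i = w} g) ⟨
  d * ∑[ v < suc n ] g v + e * g w ∎
  where
  regroup : ∀ d e x s → (d + e) * x + d * s ≡ d * (x + s) + e * x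
  regroup = solve-∀

size-almostRegular : ∀ {n} (G : Graph n) (w : Fin n) {d e} →
  degree G w ≡ d + e → (∀ v → v ≢ w → degree G v ≡ d) → size G * 2 ≡ d * n + e
size-almostRegular {n} G w {d} {e} deg-w deg-v = begin
  size G * 2                                   ≡⟨ ∑-const (size G) 2 ⟨
  ∑[ k < size G ] (1 + 1)                      ≡⟨ weighted-handshake G (λ _ → 1) ⟩
  ∑[ v < n ] (degree G v * 1)                  ≡⟨ ∑-degree-*-almostRegular G w deg-w deg-v (λ _ → 1) ⟩
  d * ∑[ v < n ] 1 + e * 1                     ≡⟨ cong₂ (λ s t → d * s + t)
                                                    (trans (∑-const n 1) (*-identityʳ n)) (*-identityʳ e) ⟩
  d * n + e                                    ∎

module SuperEdgeMagicLabelling {n} (G : Graph n) (f : (Fin n ⊎ Fin (size G)) ⤖ Fin (n + size G))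
         (vertex-labels : ∀ x → ((∃ λ v → Bijection.to f (inj₁ v) ≡ x) → label x ≤ n)
                                × (label x ≤ n → ∃ λ v → Bijection.to f (inj₁ v) ≡ x)) where

  open Bijection f using (injective; surjective) renaming (to to φ)

  vertexLabel : Fin n → ℕ
  vertexLabel v = label (φ (inj₁ v))

  edgeLabel : Fin (size G) → ℕ
  edgeLabel e = label (φ (inj₂ e))

  label-injective : ∀ {x y} → label (φ x) ≡ label (φ y) → x ≡ y
  label-injective = injective ∘ toℕ-injective ∘ suc-injective

  vertexLabel-≤ : ∀ v → vertexLabel v ≤ n
  vertexLabel-≤ v = proj₁ (vertex-labels (φ (inj₁ v))) (v , refl)

  edgeLabel-> : ∀ e → n < edgeLabel e
  edgeLabel-> e = ≰⇒> λ ≤n → vertex≢edge (proj₂ (vertex-labels (φ (inj₂ e))) ≤n)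
    where
    vertex≢edge : ¬ ∃ λ v → φ (inj₁ v) ≡ φ (inj₂ e)
    vertex≢edge (v , eq) with injective eq
    ... | ()

  label-onto : ∀ {y} → y < n + size G → Σ (Fin (n + size G)) λ x → label x ≡ suc y
  label-onto y< = fromℕ< y< , cong suc (toℕ-fromℕ< y<)

  ∑-vertexLabel : 2 * ∑[ v < n ] vertexLabel v + n ≡ n * (2 * 1 + n)
  ∑-vertexLabel = trans (cong (λ s → 2 * s + n) (∑-interval-bijection n 1 vertexLabel
      (inj₁-injective ∘ label-injective) (λ _ → s≤s z≤n) (s≤s ∘ vertexLabel-≤) onto))
    (∑-arithmetic n 1)
    where
    onto : ∀ y → 1 ≤ y → y < 1 + n → ∃ λ v → vertexLabel v ≡ y
    onto (suc y) _ (s≤s y<n) with label-onto (≤-trans y<n (m≤m+n n (size G)))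
    ... | x , lx with proj₂ (vertex-labels x) (subst (_≤ n) (sym lx) y<n)
    ...   | v , φv≡x = v , trans (cong label φv≡x) lx

  ∑-edgeLabel : 2 * ∑[ e < size G ] edgeLabel e + size G ≡ size G * (2 * suc n + size G)
  ∑-edgeLabel = trans (cong (λ s → 2 * s + size G) (∑-interval-bijection (size G) (suc n) edgeLabel
      (inj₂-injective ∘ label-injective) edgeLabel-> (λ e → s≤s (toℕ<n (φ (inj₂ e)))) onto))
    (∑-arithmetic (size G) (suc n))
    where
    onto : ∀ y → suc n ≤ y → y < suc n + size G → ∃ λ e → edgeLabel e ≡ y
    onto (suc y) (s≤s n≤y) (s≤s y<) with label-onto y<
    ... | x , lx with surjective x
    ...   | inj₂ e , φe≡x = e , trans (cong label (φe≡x refl)) lx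
    ...   | inj₁ v , φv≡x =
      ⊥-elim (<⇒≱ (s≤s n≤y) (subst (_≤ n) lx (proj₁ (vertex-labels x) (v , φv≡x refl))))

  magic-constant : ∀ c → (∀ k → vertexLabel (proj₁ (edgeAt G k)) + vertexLabel (proj₂ (edgeAt G k))
                                  + edgeLabel k ≡ c) →
    size G * c ≡ ∑[ v < n ] (degree G v * vertexLabel v) + ∑[ e < size G ] edgeLabel e
  magic-constant c magic = begin
    size G * c
      ≡⟨ ∑-const (size G) c ⟨
    ∑[ k < size G ] c
      ≡⟨ sum-cong-≗ {size G} magic ⟨
    ∑[ k < size G ] (vertexLabel (proj₁ (edgeAt G k)) + vertexLabel (proj₂ (edgeAt G k)) + edgeLabel k)
      ≡⟨ ∑-distrib-+ {size G} _ edgeLabel ⟩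
    ∑[ k < size G ] (vertexLabel (proj₁ (edgeAt G k)) + vertexLabel (proj₂ (edgeAt G k)))
      + ∑[ e < size G ] edgeLabel e
      ≡⟨ cong (_+ ∑[ e < size G ] edgeLabel e) (weighted-handshake G vertexLabel) ⟩
    ∑[ v < n ] (degree G v * vertexLabel v) + ∑[ e < size G ] edgeLabel e ∎

odd-coprime-2 : ∀ k → Coprime (suc (2 * k)) 2
odd-coprime-2 zero    = 1-coprimeTo 2
odd-coprime-2 (suc k) = subst (λ m → Coprime m 2) (two-more k) (coprime-+ (odd-coprime-2 k))
  where
  two-more : ∀ k → 2 + suc (2 * k) ≡ suc (2 * suc k)
  two-more = solve-∀

odd∤double : ∀ k {a} → 0 < a → a < suc (2 * k) → ¬ suc (2 * k) ∣ 2 * a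
odd∤double k {a} 0<a a<q q∣2a =
  <⇒≱ a<q (∣⇒≤ ⦃ >-nonZero 0<a ⦄ (coprime-divisor (odd-coprime-2 k) q∣2a))

-- The label sums are A = k·q and B = q·(3k + 1), so the magic equation reduces to q·c ≡ 2a (mod q).
magic-equation⇒∣ : ∀ k {q c A B a} → q ≡ suc (2 * k) →
  q * c ≡ 2 * A + 2 * a + B →
  2 * A + 2 * k ≡ 2 * k * (2 * 1 + 2 * k) →
  2 * B + q ≡ q * (2 * suc (2 * k) + q) →
  suc (2 * k) ∣ 2 * a
magic-equation⇒∣ k {q} {c} {A} {B} {a} refl magic ∑A ∑B =
  ∣m+n∣m⇒∣n (subst (q ∣_) q*c≡ (m∣m*n c)) (m∣m*n (5 * k + 1))
  where
  A≡ : A ≡ k * q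
  A≡ = *-cancelˡ-≡ A (k * q) 2 (+-cancelʳ-≡ (2 * k) _ _ (trans ∑A (halveA k)))
    where
    halveA : ∀ k → 2 * k * (2 * 1 + 2 * k) ≡ 2 * (k * suc (2 * k)) + 2 * k
    halveA = solve-∀
  B≡ : B ≡ q * (3 * k + 1)
  B≡ = *-cancelˡ-≡ B (q * (3 * k + 1)) 2 (+-cancelʳ-≡ q _ _ (trans ∑B (halveB k)))
    where
    halveB : ∀ k → suc (2 * k) * (2 * suc (2 * k) + suc (2 * k))
                   ≡ 2 * (suc (2 * k) * (3 * k + 1)) + suc (2 * k)
    halveB = solve-∀
  q*c≡ : q * c ≡ q * (5 * k + 1) + 2 * a
  q*c≡ = trans magic (trans (cong₂ (λ s t → 2 * s + 2 * a + t) A≡ B≡) (collect k a))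
    where
    collect : ∀ k a → 2 * (k * suc (2 * k)) + 2 * a + suc (2 * k) * (3 * k + 1)
                      ≡ suc (2 * k) * (5 * k + 1) + 2 * a
    collect = solve-∀

-- The counting argument does not need the bound 6 ≤ 2k.
theorem2p1 : (k : ℕ) → 6 ≤ 2 * k → (G : Graph (2 * k)) →
    Σ (Fin (2 * k)) (λ w → degree G w ≡ 4 × (∀ v → v ≢ w → degree G v ≡ 2)) →
    ¬ IsSuperEdgeMagic G
theorem2p1 k _ G (w , deg-w , deg-v) (f , vertex-labels , c , magic) =
  odd∤double k (s≤s z≤n) (s≤s (vertexLabel-≤ w))
    (magic-equation⇒∣ k {A = ∑[ v < 2 * k ] vertexLabel v} {B = ∑[ e < size G ] edgeLabel e}
                        {a = vertexLabel w} size≡ magic-sum ∑-vertexLabel ∑-edgeLabel)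
  where
  open SuperEdgeMagicLabelling G f vertex-labels
  size≡ : size G ≡ suc (2 * k)
  size≡ = *-cancelʳ-≡ (size G) _ 2 (trans (size-almostRegular G w deg-w deg-v) (double-suc (2 * k)))
    where
    double-suc : ∀ m → 2 * m + 2 ≡ suc m * 2
    double-suc = solve-∀
  magic-sum : size G * c ≡ 2 * ∑[ v < 2 * k ] vertexLabel v + 2 * vertexLabel w + ∑[ e < size G ] edgeLabel e
  magic-sum = trans (magic-constant c magic)
    (cong (_+ ∑[ e < size G ] edgeLabel e) (∑-degree-*-almostRegular G w deg-w deg-v vertexLabel))
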